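{- Let $S=(\Sigma,Q,\Delta,q_0)$ be a collapsible pushdown system of level $2$. If $s,t,m\in\mathrm{Stacks}(\Sigma)$ with $m\in\mathrm{Milestones}(t)$ but $m\not\le s$, then every run of $S$ from (a configuration with stack) $s$ to (a configuration with stack) $t$ visits $m$. Consequently, for every run $r$ of $S$ from the initial configuration $(q_0,\bot_2)$ to a configuration with stack $s$, the function $f:\mathrm{Milestones}(s)\to\mathrm{dom}(r)$, $s'\mapsto\max\{i\in\mathrm{dom}(r): r(i)=(q,s')\text{ for some }q\in Q\}$, is an order embedding from $(\mathrm{Milestones}(s),\le)$ into $(\mathrm{dom}(r),\le)$.
   Context: Collapsible pushdown stacks of level 2. Fix a finite alphabet $\Sigma$ containing $\bot$. A $2$-word over $\Gamma$ is a finite sequence $s=w_1:\dots:w_n$ of words over $\Gamma$. Stack letters are triples in $\Sigma\times\{1,2\}\times\mathbb N$. For $s=w_1:\dots:w_n$, $n\ge1$, $w_n=a_1\dots a_m$, $m\ge1$, $a_m=(\sigma,i,j)$: $\mathrm{Sym}(s)=\sigma$, $\mathrm{Lvl}(s)=i$, $\mathrm{Lnk}(s)=j$. Operations: $\mathrm{Pop}_2(s)=w_1:\dots:w_{n-1}$ if $n\ge2$; $\mathrm{Pop}_1(s)=w_1:\dots:w_{n-1}:a_1\dots a_{m-1}$ if $m\ge2$; $\mathrm{Clone}_2(s)=w_1:\dots:w_n:w_n$; for $\sigma\ne\bot$, $\mathrm{Push}_{\sigma,2}(s)=w_1:\dots:w_{n-1}:w_n(\sigma,2,n-1)$, $\mathrm{Push}_{\sigma,1}(s)=w_1:\dots:w_{n-1}:w_n(\sigma,1,m)$;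 $\mathrm{Collapse}(s)=w_1:\dots:w_r$ if $\mathrm{Lvl}(s)=2,\mathrm{Lnk}(s)=r>0$, $=\mathrm{Pop}_1(s)$ if $\mathrm{Lvl}(s)=1$; undefined otherwise. $\mathrm{Op}$ is the set of these operations; $\bot_2$ is the $2$-word consisting of the one-letter word $(\bot,1,0)$; $\mathrm{Stacks}(\Sigma)$ is the smallest set containing $\bot_2$ closed under $\mathrm{Op}$. A CPS is $S=(\Sigma,Q,\Delta,q_0)$, $Q$ finite, $q_0\in Q$, $\Delta\subseteq Q\times\Sigma\times Q\times\mathrm{Op}$; $(q_1,s)\to(q_2,t)$ iff some $(q_1,\sigma,q_2,op)\in\Delta$ has $\mathrm{Sym}(s)=\sigma$, $op(s)=t$. A run of length $n$ is a map $r:\{0,\dots,n\}\to Q\times(\Sigma\times\{1,2\}\times\mathbb N)^{*2}$ with $r(0)\to r(1)\to\dots\to r(n)$; it is a run from $r(0)$ to $r(n)$ and visits stack $s$ at $i$ if $r(i)=(q,s)$ for some $q$. Substacks: $s'\le s$ iff $s'=\mathrm{Pop}_1^{n_1}(\mathrm{Pop}_2^{n_2}(s))$ for some $n_1,n_2\in\mathbb N$. Milestones: for $s=w_1:\dots:w_n$, a substack $s'$ of $s$ is a milestone of $s$ if $s'=w_1:\dots:w_i:w'$ for some $0\le i<n$ and some word $w'$ with $w_i\sqcap w_{i+1}\le w'\le w_{i+1}$, where $\le$ on words is the prefix order, $u\sqcap v$ is the longest common prefix, and $w_0:=\varepsilon$. $\mathrm{Milestones}(s)$ is the set of milestones of $s$,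 ordered by $\le$. -}

module Defs where

open import Data.Nat using (ℕ; zero; suc; _<_; _≤ᵇ_)
import Data.Nat as ℕ
open import Data.Bool using (true; false)
open import Data.Fin using (Fin; zero; suc; inject₁; fromℕ)
import Data.Fin as F
open import Data.List using (List; []; _∷_; _∷ʳ_; _++_; length; take)
open import Data.Maybe using (Maybe; just; nothing; _>>=_)
import Data.Maybe as M
open import Data.Product using (Σ; ∃; ∃₂; _×_; _,_; proj₁; proj₂)
import Data.Product.Properties as PP
open import Relation.Nullary using (¬_; yes; no)
open import Relation.Binary.Definitions using (DecidableEquality)
open import Relation.Binary.PropositionalEquality using (_≡_; refl)

-- Alphabet: Σ = Fin (suc k), with ⊥ = zero; the non-⊥ symbols are
-- suc σ for σ : Fin k.

data Lvl : Set where
  one two : Lvl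

_≟ᴸ_ : DecidableEquality Lvl
one ≟ᴸ one = yes refl
one ≟ᴸ two = no λ ()
two ≟ᴸ one = no λ ()
two ≟ᴸ two = yes refl

-- stack letters (σ , level , link)
Letter : ℕ → Set
Letter k = Fin (suc k) × Lvl × ℕ

_≟ₗ_ : ∀ {k} → DecidableEquality (Letter k)
_≟ₗ_ = PP.≡-dec F._≟_ (PP.≡-dec _≟ᴸ_ ℕ._≟_)

-- words a₁ … aₘ (list in this order, aₘ = last element)
Word : ℕ → Set
Word k = List (Letter k)

-- 2-words w₁ : … : wₙ (list in this order, wₙ = last element = top)
Stack : ℕ → Set
Stack k = List (Word k)

unsnoc : ∀ {A : Set} → List A → Maybe (List A × A)
unsnoc [] = nothing
unsnoc (x ∷ xs) with unsnoc xs
... | nothing = just ([] , x)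
... | just (ys , y) = just (x ∷ ys , y)

topLetter : ∀ {k} → Stack k → Maybe (Letter k)
topLetter s = unsnoc s >>= λ p → unsnoc (proj₂ p) >>= λ q → just (proj₂ q)

Sym : ∀ {k} → Stack k → Maybe (Fin (suc k))
Sym s = M.map proj₁ (topLetter s)

-- operations (push σ l  is Push_{suc σ , l}, so σ ≠ ⊥)
data Op (k : ℕ) : Set where
  pop1 pop2 clone2 collapse : Op k
  push : Fin k → Lvl → Op k

Pop₂ : ∀ {k} → Stack k → Maybe (Stack k)
Pop₂ s with unsnoc s
... | nothing = nothing
... | just ([] , _) = nothing
... | just (ws@(_ ∷ _) , _) = just ws

Pop₁ : ∀ {k} → Stack k → Maybe (Stack k)
Pop₁ s with unsnoc s
... | nothing = nothing
... | just (ws , w) with unsnoc w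
...   | nothing = nothing
...   | just ([] , _) = nothing
...   | just (as@(_ ∷ _) , _) = just (ws ∷ʳ as)

Clone₂ : ∀ {k} → Stack k → Maybe (Stack k)
Clone₂ s with unsnoc s
... | nothing = nothing
... | just (ws , w) = just (ws ∷ʳ w ∷ʳ w)

Push : ∀ {k} → Fin k → Lvl → Stack k → Maybe (Stack k)
Push σ l s with unsnoc s
... | nothing = nothing
... | just (ws , w) with l
...   | two = just (ws ∷ʳ (w ∷ʳ (suc σ , two , length ws)))
...   | one = just (ws ∷ʳ (w ∷ʳ (suc σ , one , length w)))

Collapse : ∀ {k} → Stack k → Maybe (Stack k)
Collapse s with topLetter s
... | nothing = nothing
... | just (_ , one , _) = Pop₁ s
... | just (_ , two , zero) = nothing
... | just (_ , two , suc r) with suc r ≤ᵇ length s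
...   | true = just (take (suc r) s)
...   | false = nothing

apply : ∀ {k} → Op k → Stack k → Maybe (Stack k)
apply pop1 = Pop₁
apply pop2 = Pop₂
apply clone2 = Clone₂
apply collapse = Collapse
apply (push σ l) = Push σ l

bot₂ : ∀ {k} → Stack k
bot₂ = ((zero , one , 0) ∷ []) ∷ []

data IsStack {k : ℕ} : Stack k → Set where
  base : IsStack bot₂
  step : ∀ {s t} (op : Op k) → IsStack s → apply op s ≡ just t → IsStack t

iterM : ∀ {A : Set} → (A → Maybe A) → ℕ → A → Maybe A
iterM f zero a = just a
iterM f (suc n) a = f a >>= iterM f n

_⊑_ : ∀ {k} → Stack k → Stack k → Set
s' ⊑ s = ∃₂ λ n₁ n₂ → (iterM Pop₂ n₂ s >>= iterM Pop₁ n₁) ≡ just s'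

_≼_ : ∀ {k} → Word k → Word k → Set
u ≼ w = ∃ λ v → u ++ v ≡ w

lcp : ∀ {k} → Word k → Word k → Word k
lcp (a ∷ u) (b ∷ v) with a ≟ₗ b
... | yes _ = a ∷ lcp u v
... | no _ = []
lcp _ _ = []

-- wordAt s i = wᵢ for 1 ≤ i ≤ n, with w₀ = ε
wordAt : ∀ {k} → Stack k → ℕ → Word k
wordAt s zero = []
wordAt [] (suc i) = []
wordAt (w ∷ s) (suc zero) = w
wordAt (w ∷ s) (suc (suc i)) = wordAt s (suc i)

IsMilestone : ∀ {k} → Stack k → Stack k → Set
IsMilestone m s =
  m ⊑ s ×
  ∃ λ i → i < length s ×
    ∃ λ w' → m ≡ take i s ∷ʳ w'
           × lcp (wordAt s i) (wordAt s (suc i)) ≼ w'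
           × w' ≼ wordAt s (suc i)

record CPS (k : ℕ) : Set₁ where
  field
    nQ : ℕ
    Δ  : Fin nQ → Fin (suc k) → Fin nQ → Op k → Set
    q₀ : Fin nQ

module _ {k : ℕ} (S : CPS k) where
  open CPS S

  Config : Set
  Config = Fin nQ × Stack k

  Step : Config → Config → Set
  Step (q₁ , s) (q₂ , t) =
    ∃₂ λ σ op → Δ q₁ σ q₂ op × Sym s ≡ just σ × apply op s ≡ just t

  IsRun : (n : ℕ) → (Fin (suc n) → Config) → Set
  IsRun n r = (i : Fin n) → Step (r (inject₁ i)) (r (suc i))

Visits : ∀ {k nQ n} → (Fin (suc n) → Fin nQ × Stack k) → Stack k → Set
Visits r m = ∃ λ i → proj₂ (r i) ≡ m

IsLastVisit : ∀ {k nQ n} → (Fin (suc n) → Fin nQ × Stack k) → Stack k → Fin (suc n) → Set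
IsLastVisit r m i = proj₂ (r i) ≡ m × (∀ j → proj₂ (r j) ≡ m → j F.≤ i)

-- A stack operation either drops topmost words or changes only the top word,
-- so a milestone of the result of one step is either that result itself or
-- already a milestone of the stack the step started from.  Following a run backwards, a milestone of
-- the final stack is therefore either visited or a milestone, hence a
-- substack, of the initial stack.  Milestones of a stack are linearly ordered
-- by ⊑, which is antisymmetric, and a visit to a substack of a milestone m
-- cannot come after the last visit to m; this makes last visits monotone.
module Submission where

open import Defs
open import Data.Nat using (ℕ; zero; suc; z≤n; s≤s; _<_; _≤ᵇ_)
import Data.Nat as ℕ
import Data.Nat.Properties as ℕP
open import Data.Nat.ListAction using (sum)
open import Data.Nat.ListAction.Properties using (sum-++)
open import Data.Bool using (true; false)
open import Data.Fin using (Fin; zero; suc; fromℕ; _≤_)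
import Data.Fin.Properties as FinP
open import Data.List using (List; []; _∷_; _∷ʳ_; _++_; [_]; length; take; drop; map)
open import Data.List.Properties
  using (++-assoc; ++-identityʳ; ++-identityʳ-unique; ++-conicalˡ; ++-conicalʳ;
         length-++; length-++-≤ˡ; map-++; take-all; take++drop≡id; ≡-dec)
open import Data.List.Reverse using (Reverse; []; _∶_∶ʳ_; reverseView)
open import Data.List.Relation.Unary.All using (All; []; _∷_)
open import Data.List.Relation.Unary.All.Properties using (∷ʳ⁺; ∷ʳ⁻; ++⁻ˡ)
open import Data.Maybe using (Maybe; just; nothing; _>>=_)
open import Data.Product using (∃; ∃₂; _×_; _,_; proj₁; proj₂)
open import Data.Sum using (_⊎_; inj₁; inj₂)
import Data.Sum as Sum
open import Data.Empty using (⊥-elim)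
open import Function using (_∘_; id)
open import Relation.Nullary using (¬_; yes; no)
open import Level using (0ℓ)
open import Relation.Unary using (Pred; Decidable)
open import Relation.Binary.PropositionalEquality
  using (_≡_; _≢_; refl; sym; trans; cong; subst)

module _ {A : Set} where

  unsnoc-∷ʳ : (xs : List A) (x : A) → unsnoc (xs ∷ʳ x) ≡ just (xs , x)
  unsnoc-∷ʳ []       x = refl
  unsnoc-∷ʳ (y ∷ ys) x rewrite unsnoc-∷ʳ ys x = refl

  unsnoc≡just⇒ : ∀ {xs ys : List A} {y} → unsnoc xs ≡ just (ys , y) → xs ≡ ys ∷ʳ y
  unsnoc≡just⇒ {xs} eq with reverseView xs
  unsnoc≡just⇒ ()  | []
  unsnoc≡just⇒ eq | ys ∶ _ ∶ʳ y with refl ← trans (sym (unsnoc-∷ʳ ys y)) eq = refl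

  length-∷ʳ : (xs : List A) (x : A) → length (xs ∷ʳ x) ≡ suc (length xs)
  length-∷ʳ xs x = trans (length-++ xs) (ℕP.+-comm (length xs) 1)

  ∷ʳ≢[] : (xs : List A) (x : A) → xs ∷ʳ x ≢ []
  ∷ʳ≢[] xs x eq with () ← ++-conicalʳ xs [ x ] eq

  >>=≡just⇒ : ∀ {B : Set} {mx : Maybe A} {g : A → Maybe B} {y} →
              (mx >>= g) ≡ just y → ∃ λ x → mx ≡ just x × g x ≡ just y
  >>=≡just⇒ {mx = just x} eq = x , refl , eq

module _ {k : ℕ} where

  ≼-refl : (u : Word k) → u ≼ u
  ≼-refl u = [] , ++-identityʳ u

  ≼-trans : {u v w : Word k} → u ≼ v → v ≼ w → u ≼ w
  ≼-trans {u} (d , refl) (e , refl) = d ++ e , sym (++-assoc u d e)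

  ≼-antisym : {u v : Word k} → u ≼ v → v ≼ u → u ≡ v
  ≼-antisym {u} (d , refl) (e , eq)
    with refl ← ++-conicalˡ d e (++-identityʳ-unique u (sym (trans (sym (++-assoc u d e)) eq)))
    = sym (++-identityʳ u)

  ≼-++ : (u d : Word k) → u ≼ (u ++ d)
  ≼-++ u d = d , refl

  []≼ : (u : Word k) → [] ≼ u
  []≼ u = u , refl

  ≼[]⇒≡[] : {u : Word k} → u ≼ [] → u ≡ []
  ≼[]⇒≡[] {u} (d , eq) = ++-conicalˡ u d eq

  ∷-≼-∷ : ∀ {a} {u v : Word k} → u ≼ v → (a ∷ u) ≼ (a ∷ v)
  ∷-≼-∷ (d , refl) = d , refl

  ∷-≼-∷⁻ : ∀ {a b} {u v : Word k} → (a ∷ u) ≼ (b ∷ v) → a ≡ b × u ≼ v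
  ∷-≼-∷⁻ (d , refl) = refl , (d , refl)

  ≼-comparable : {u v w : Word k} → u ≼ w → v ≼ w → u ≼ v ⊎ v ≼ u
  ≼-comparable {[]}                   _ _ = inj₁ ([]≼ _)
  ≼-comparable {_ ∷ _} {[]}           _ _ = inj₂ ([]≼ _)
  ≼-comparable {_ ∷ _} {_ ∷ _} {[]}   (_ , ()) _
  ≼-comparable {_ ∷ _} {_ ∷ _} {_ ∷ _} p q with ∷-≼-∷⁻ p | ∷-≼-∷⁻ q
  ... | refl , p′ | refl , q′ = Sum.map ∷-≼-∷ ∷-≼-∷ (≼-comparable p′ q′)

  ≼-∷ʳ⁻ : ∀ {u : Word k} w {b} → u ≼ (w ∷ʳ b) → u ≡ w ∷ʳ b ⊎ u ≼ w
  ≼-∷ʳ⁻ {[]}         w       _             = inj₂ ([]≼ w)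
  ≼-∷ʳ⁻ {_ ∷ []}     []      ([] , refl)   = inj₁ refl
  ≼-∷ʳ⁻ {_ ∷ []}     []      (_ ∷ _ , ())
  ≼-∷ʳ⁻ {_ ∷ _ ∷ _}  []      (_ , ())
  ≼-∷ʳ⁻ {a ∷ _}      (_ ∷ w) p with refl , p′ ← ∷-≼-∷⁻ p =
    Sum.map (cong (a ∷_)) ∷-≼-∷ (≼-∷ʳ⁻ w p′)

  lcp-≼ˡ : (u v : Word k) → lcp u v ≼ u
  lcp-≼ˡ []      _ = []≼ _
  lcp-≼ˡ (_ ∷ _) [] = []≼ _
  lcp-≼ˡ (a ∷ u) (b ∷ v) with a ≟ₗ b
  ... | yes _ = ∷-≼-∷ (lcp-≼ˡ u v)
  ... | no  _ = []≼ _

  lcp-≼ʳ : (u v : Word k) → lcp u v ≼ v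
  lcp-≼ʳ []      _ = []≼ _
  lcp-≼ʳ (_ ∷ _) [] = []≼ _
  lcp-≼ʳ (a ∷ u) (b ∷ v) with a ≟ₗ b
  ... | yes refl = ∷-≼-∷ (lcp-≼ʳ u v)
  ... | no  _    = []≼ _

  lcp-greatest : {c u v : Word k} → c ≼ u → c ≼ v → c ≼ lcp u v
  lcp-greatest {[]}    _ _ = []≼ _
  lcp-greatest {_ ∷ _} {[]} (_ , ()) _
  lcp-greatest {_ ∷ _} {_ ∷ _} {[]} _ (_ , ())
  lcp-greatest {_ ∷ _} {a ∷ _} {b ∷ _} p q with ∷-≼-∷⁻ p | ∷-≼-∷⁻ q
  ... | refl , p′ | refl , q′ with a ≟ₗ b
  ...   | yes _  = ∷-≼-∷ (lcp-greatest p′ q′)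
  ...   | no a≢a = ⊥-elim (a≢a refl)

  lastWord : Stack k → Word k
  lastWord ws = wordAt ws (length ws)

  take-++ˡ : ∀ i (xs ys : Stack k) → i ℕ.≤ length xs → take i (xs ++ ys) ≡ take i xs
  take-++ˡ zero    _        _  _         = refl
  take-++ˡ (suc i) (x ∷ xs) ys (s≤s i≤n) = cong (x ∷_) (take-++ˡ i xs ys i≤n)

  wordAt-++ˡ : ∀ i (xs ys : Stack k) → i ℕ.≤ length xs → wordAt (xs ++ ys) i ≡ wordAt xs i
  wordAt-++ˡ zero          _        _  _         = refl
  wordAt-++ˡ (suc zero)    (_ ∷ _)  _  _         = refl
  wordAt-++ˡ (suc (suc i)) (_ ∷ xs) ys (s≤s i≤n) = wordAt-++ˡ (suc i) xs ys i≤n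

  wordAt-∷ʳ : (ws : Stack k) (w : Word k) → wordAt (ws ∷ʳ w) (suc (length ws)) ≡ w
  wordAt-∷ʳ []           _ = refl
  wordAt-∷ʳ (_ ∷ [])     _ = refl
  wordAt-∷ʳ (_ ∷ v ∷ ws) w = wordAt-∷ʳ (v ∷ ws) w

  lastWord-∷ʳ : (ws : Stack k) (w : Word k) → lastWord (ws ∷ʳ w) ≡ w
  lastWord-∷ʳ ws w = trans (cong (wordAt (ws ∷ʳ w)) (length-∷ʳ ws w)) (wordAt-∷ʳ ws w)

  -- The milestones ws : w′ of the paper with |ws| = i, u = wᵢ and v = wᵢ₊₁,
  -- restricted to w′ ≠ ε (automatic when the milestone is a stack).  Milestone
  -- drops the conjunct m ⊑ s of IsMilestone; it is recovered by Milestone⇒⊑.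
  MilestoneOn : Stack k → Stack k → Word k → Word k → Set
  MilestoneOn m ws u v = ∃ λ w′ → m ≡ ws ∷ʳ w′ × lcp u v ≼ w′ × w′ ≼ v × w′ ≢ []

  MilestoneAt : ℕ → Stack k → Stack k → Set
  MilestoneAt i m s = MilestoneOn m (take i s) (wordAt s i) (wordAt s (suc i))

  Milestone : Stack k → Stack k → Set
  Milestone m s = ∃ λ i → i < length s × MilestoneAt i m s

  MilestoneAt-++ : ∀ {i m} (xs ys : Stack k) → i < length xs →
                   MilestoneAt i m (xs ++ ys) ≡ MilestoneAt i m xs
  MilestoneAt-++ {i} xs ys i<n
    rewrite take-++ˡ i xs ys (ℕP.<⇒≤ i<n)
          | wordAt-++ˡ i xs ys (ℕP.<⇒≤ i<n)
          | wordAt-++ˡ (suc i) xs ys i<n = refl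

  MilestoneAt-last : ∀ {m} (ws : Stack k) (v : Word k) →
                     MilestoneAt (length ws) m (ws ∷ʳ v) ≡ MilestoneOn m ws (lastWord ws) v
  MilestoneAt-last ws v
    rewrite take-++ˡ (length ws) ws [ v ] ℕP.≤-refl
          | take-all (length ws) ws ℕP.≤-refl
          | wordAt-++ˡ (length ws) ws [ v ] ℕP.≤-refl
          | wordAt-∷ʳ ws v = refl

  Milestone-++⁺ : ∀ {m} {xs : Stack k} ys → Milestone m xs → Milestone m (xs ++ ys)
  Milestone-++⁺ {xs = xs} ys (i , i<n , M) =
    i , ℕP.<-≤-trans i<n (length-++-≤ˡ xs) , subst id (sym (MilestoneAt-++ xs ys i<n)) M

  Milestone-last : ∀ {m} (ws : Stack k) {v} →
                   MilestoneOn m ws (lastWord ws) v → Milestone m (ws ∷ʳ v)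
  Milestone-last ws {v} M =
    length ws , ℕP.≤-reflexive (sym (length-∷ʳ ws v)) , subst id (sym (MilestoneAt-last ws v)) M

  Milestone-∷ʳ⁻ : ∀ {m} (ws : Stack k) {v} → Milestone m (ws ∷ʳ v) →
                  Milestone m ws ⊎ MilestoneOn m ws (lastWord ws) v
  Milestone-∷ʳ⁻ ws {v} (i , i<n , M)
    with ℕP.m<1+n⇒m<n∨m≡n (subst (i <_) (length-∷ʳ ws v) i<n)
  ... | inj₁ i<m = inj₁ (i , i<m , subst id (MilestoneAt-++ ws [ v ] i<m) M)
  ... | inj₂ refl = inj₂ (subst id (MilestoneAt-last ws v) M)

  Milestone-[] : ∀ {m} → ¬ Milestone m []
  Milestone-[] (_ , () , _)

  -- Either lcp u v′ is a prefix of v, hence of lcp u v, or v is a prefix of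
  -- lcp u v′ ≼ u; then lcp u v = v and w′ is squeezed to v.
  MilestoneOn-extend : ∀ {m ws u v v′} → v ≼ v′ → MilestoneOn m ws u v →
                       m ≡ ws ∷ʳ v ⊎ MilestoneOn m ws u v′
  MilestoneOn-extend {ws = ws} {u} {v} {v′} v≼v′ (w′ , refl , l≼w′ , w′≼v , w′≢[])
    with ≼-comparable (lcp-≼ʳ u v′) v≼v′
  ... | inj₁ l′≼v = inj₂ (w′ , refl , ≼-trans (lcp-greatest (lcp-≼ˡ u v′) l′≼v) l≼w′ ,
                          ≼-trans w′≼v v≼v′ , w′≢[])
  ... | inj₂ v≼l′ = inj₁ (cong (ws ∷ʳ_) (≼-antisym w′≼v v≼w′))
    where
      v≼w′ : v ≼ w′
      v≼w′ = ≼-trans (lcp-greatest (≼-trans v≼l′ (lcp-≼ˡ u v′)) (≼-refl v)) l≼w′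

  MilestoneOn-∷ʳ⁻ : ∀ {m ws u w b} → MilestoneOn m ws u (w ∷ʳ b) →
                    m ≡ ws ∷ʳ (w ∷ʳ b) ⊎ MilestoneOn m ws u w
  MilestoneOn-∷ʳ⁻ {ws = ws} {u} {w} {b} (w′ , refl , l≼w′ , w′≼wb , w′≢[]) =
    Sum.map (cong (ws ∷ʳ_)) (λ w′≼w → w′ , refl , ≼-trans lcp-mono l≼w′ , w′≼w , w′≢[])
            (≼-∷ʳ⁻ w w′≼wb)
    where
      lcp-mono : lcp u w ≼ lcp u (w ∷ʳ b)
      lcp-mono = lcp-greatest (lcp-≼ˡ u w) (≼-trans (lcp-≼ʳ u w) (≼-++ w [ b ]))

  MilestoneOn-self : ∀ {m ws w} → MilestoneOn m ws w w → m ≡ ws ∷ʳ w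
  MilestoneOn-self {ws = ws} {w} (w′ , refl , l≼w′ , w′≼w , _) =
    cong (ws ∷ʳ_) (≼-antisym w′≼w (≼-trans (lcp-greatest (≼-refl w) (≼-refl w)) l≼w′))

  -- Pop₂ and level-2 collapses are both instances of prefix.
  infix 4 _↝_
  data _↝_ : Stack k → Stack k → Set where
    prefix : ∀ xs ys → xs ++ ys ↝ xs
    pop₁   : ∀ {ws v a} → v ≢ [] → ws ∷ʳ (v ∷ʳ a) ↝ ws ∷ʳ v
    clone₂ : ∀ {ws w} → ws ∷ʳ w ↝ ws ∷ʳ w ∷ʳ w
    push   : ∀ {ws w a} → ws ∷ʳ w ↝ ws ∷ʳ (w ∷ʳ a)

  Milestone-↝⁻ : ∀ {m s t} → s ↝ t → Milestone m t → m ≡ t ⊎ Milestone m s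
  Milestone-↝⁻ (prefix xs ys) M = inj₂ (Milestone-++⁺ ys M)
  Milestone-↝⁻ (pop₁ {ws} {v} {a} _) M with Milestone-∷ʳ⁻ ws M
  ... | inj₁ M′ = inj₂ (Milestone-++⁺ _ M′)
  ... | inj₂ T  =
    Sum.map₂ (Milestone-last ws) (MilestoneOn-extend {u = lastWord ws} (≼-++ v [ a ]) T)
  Milestone-↝⁻ (clone₂ {ws} {w}) M with Milestone-∷ʳ⁻ (ws ∷ʳ w) M
  ... | inj₁ M′ = inj₂ M′
  ... | inj₂ T  =
    inj₁ (MilestoneOn-self (subst (λ u → MilestoneOn _ (ws ∷ʳ w) u w) (lastWord-∷ʳ ws w) T))
  Milestone-↝⁻ (push {ws}) M with Milestone-∷ʳ⁻ ws M
  ... | inj₁ M′ = inj₂ (Milestone-++⁺ _ M′)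
  ... | inj₂ T  = Sum.map₂ (Milestone-last ws) (MilestoneOn-∷ʳ⁻ {u = lastWord ws} T)

  Pop₂≡just⇒ : ∀ {s t : Stack k} → Pop₂ s ≡ just t → ∃ λ w → s ≡ t ∷ʳ w
  Pop₂≡just⇒ {s} eq with unsnoc s in e
  Pop₂≡just⇒ ()   | nothing
  Pop₂≡just⇒ ()   | just ([] , _)
  Pop₂≡just⇒ refl | just (_ ∷ _ , w) = w , unsnoc≡just⇒ e

  Pop₁≡just⇒ : ∀ {s t : Stack k} → Pop₁ s ≡ just t →
               ∃₂ λ ws v → ∃ λ a → v ≢ [] × s ≡ ws ∷ʳ (v ∷ʳ a) × t ≡ ws ∷ʳ v
  Pop₁≡just⇒ {s} eq with unsnoc s in e
  Pop₁≡just⇒ ()   | nothing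
  ... | just (ws , w) with unsnoc w in e′
  Pop₁≡just⇒ ()   | just _ | nothing
  Pop₁≡just⇒ ()   | just _ | just ([] , _)
  Pop₁≡just⇒ refl | just (ws , w) | just (v@(_ ∷ _) , a) =
    ws , v , a , (λ ()) , trans (unsnoc≡just⇒ e) (cong (ws ∷ʳ_) (unsnoc≡just⇒ e′)) , refl

  Pop₂⇒↝ : ∀ {s t : Stack k} → Pop₂ s ≡ just t → s ↝ t
  Pop₂⇒↝ {s} eq with w , refl ← Pop₂≡just⇒ {s} eq = prefix _ [ w ]

  Pop₁⇒↝ : ∀ {s t : Stack k} → Pop₁ s ≡ just t → s ↝ t
  Pop₁⇒↝ {s} eq with _ , _ , _ , v≢[] , refl , refl ← Pop₁≡just⇒ {s} eq = pop₁ v≢[]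

  Clone₂⇒↝ : ∀ {s t : Stack k} → Clone₂ s ≡ just t → s ↝ t
  Clone₂⇒↝ {s} eq with unsnoc s in e
  Clone₂⇒↝ ()   | nothing
  Clone₂⇒↝ refl | just _ = subst (_↝ _) (sym (unsnoc≡just⇒ e)) clone₂

  Push⇒↝ : ∀ {s t : Stack k} σ l → Push σ l s ≡ just t → s ↝ t
  Push⇒↝ {s} σ l eq with unsnoc s in e
  Push⇒↝ σ l ()     | nothing
  Push⇒↝ σ two refl | just _ = subst (_↝ _) (sym (unsnoc≡just⇒ e)) push
  Push⇒↝ σ one refl | just _ = subst (_↝ _) (sym (unsnoc≡just⇒ e)) push

  take-↝ : ∀ j (s : Stack k) → s ↝ take j s
  take-↝ j s = subst (_↝ take j s) (take++drop≡id j s) (prefix (take j s) (drop j s))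

  Collapse⇒↝ : ∀ {s t : Stack k} → Collapse s ≡ just t → s ↝ t
  Collapse⇒↝ {s} eq with topLetter s
  Collapse⇒↝ ()   | nothing
  Collapse⇒↝ eq   | just (_ , one , _) = Pop₁⇒↝ eq
  Collapse⇒↝ ()   | just (_ , two , zero)
  ... | just (_ , two , suc j) with suc j ≤ᵇ length s
  Collapse⇒↝ {s} refl | just (_ , two , suc j) | true = take-↝ (suc j) s
  Collapse⇒↝ ()   | just (_ , two , suc j) | false

  apply⇒↝ : ∀ op {s t : Stack k} → apply op s ≡ just t → s ↝ t
  apply⇒↝ pop1       = Pop₁⇒↝
  apply⇒↝ pop2       = Pop₂⇒↝
  apply⇒↝ clone2     = Clone₂⇒↝
  apply⇒↝ collapse   = Collapse⇒↝
  apply⇒↝ (push σ l) = Push⇒↝ σ l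

  NonEmptyWords : Stack k → Set
  NonEmptyWords = All (λ w → w ≢ [])

  ↝-NonEmptyWords : ∀ {s t} → s ↝ t → NonEmptyWords s → NonEmptyWords t
  ↝-NonEmptyWords (prefix xs _)           ne = ++⁻ˡ xs ne
  ↝-NonEmptyWords (pop₁ v≢[])            ne = ∷ʳ⁺ (proj₁ (∷ʳ⁻ ne)) v≢[]
  ↝-NonEmptyWords clone₂                  ne = ∷ʳ⁺ ne (proj₂ (∷ʳ⁻ ne))
  ↝-NonEmptyWords (push {w = w} {a = a})  ne = ∷ʳ⁺ (proj₁ (∷ʳ⁻ ne)) (∷ʳ≢[] w a)

  IsStack⇒NonEmptyWords : ∀ {s} → IsStack s → NonEmptyWords s
  IsStack⇒NonEmptyWords base          = (λ ()) ∷ []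
  IsStack⇒NonEmptyWords (step op p e) = ↝-NonEmptyWords (apply⇒↝ op e) (IsStack⇒NonEmptyWords p)

  IsMilestone⇒Milestone : ∀ {m s} → IsStack m → IsMilestone m s → Milestone m s
  IsMilestone⇒Milestone m-stack (_ , i , i<n , w′ , refl , l≼w′ , w′≼v) =
    i , i<n , w′ , refl , l≼w′ , w′≼v , proj₂ (∷ʳ⁻ (IsStack⇒NonEmptyWords m-stack))

  Milestone-bot₂ : ∀ {m} → Milestone m bot₂ → m ≡ bot₂
  Milestone-bot₂ M with Milestone-∷ʳ⁻ [] M
  ... | inj₁ M′ = ⊥-elim (Milestone-[] M′)
  ... | inj₂ (w′ , refl , _ , w′≼⊥ , w′≢[]) with ≼-∷ʳ⁻ [] w′≼⊥
  ...   | inj₁ refl = refl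
  ...   | inj₂ w′≼[] = ⊥-elim (w′≢[] (≼[]⇒≡[] w′≼[]))

  Pop₂-∷ʳ : ∀ {ws : Stack k} {w} → ws ≢ [] → Pop₂ (ws ∷ʳ w) ≡ just ws
  Pop₂-∷ʳ {[]}       ws≢[] = ⊥-elim (ws≢[] refl)
  Pop₂-∷ʳ {v ∷ ws} {w} _   rewrite unsnoc-∷ʳ (v ∷ ws) w = refl

  Pop₁-∷ʳ : ∀ {ws : Stack k} {v a} → v ≢ [] → Pop₁ (ws ∷ʳ (v ∷ʳ a)) ≡ just (ws ∷ʳ v)
  Pop₁-∷ʳ {v = []}    v≢[] = ⊥-elim (v≢[] refl)
  Pop₁-∷ʳ {ws} {b ∷ v} {a} _
    rewrite unsnoc-∷ʳ ws ((b ∷ v) ∷ʳ a) | unsnoc-∷ʳ (b ∷ v) a = refl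

  ⊑-refl : (s : Stack k) → s ⊑ s
  ⊑-refl s = 0 , 0 , refl

  ⊑-∷ʳ : ∀ {m ws : Stack k} {w} → ws ≢ [] → m ⊑ ws → m ⊑ (ws ∷ʳ w)
  ⊑-∷ʳ {m} {ws} {w} ws≢[] (n₁ , n₂ , eq) = n₁ , suc n₂ , goal
    where
      goal : (Pop₂ (ws ∷ʳ w) >>= iterM Pop₂ n₂ >>= iterM Pop₁ n₁) ≡ just m
      goal rewrite Pop₂-∷ʳ {w = w} ws≢[] = eq

  Pop₁-reaches : ∀ {ws : Stack k} {u v} → Reverse v → u ≢ [] → u ≼ v →
                 ∃ λ n → iterM Pop₁ n (ws ∷ʳ v) ≡ just (ws ∷ʳ u)
  Pop₁-reaches []              u≢[] u≼[]  = ⊥-elim (u≢[] (≼[]⇒≡[] u≼[]))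
  Pop₁-reaches {ws} {u} (v ∶ rv ∶ʳ a) u≢[] u≼va with ≼-∷ʳ⁻ v u≼va
  ... | inj₁ refl = 0 , refl
  ... | inj₂ u≼v with n , eq ← Pop₁-reaches {ws} rv u≢[] u≼v = suc n , goal
    where
      goal : (Pop₁ (ws ∷ʳ (v ∷ʳ a)) >>= iterM Pop₁ n) ≡ just (ws ∷ʳ u)
      goal rewrite Pop₁-∷ʳ {ws} {v} {a} (λ { refl → u≢[] (≼[]⇒≡[] u≼v) }) = eq

  ∷ʳ-⊑-∷ʳ : ∀ {ws : Stack k} {u v} → u ≢ [] → u ≼ v → (ws ∷ʳ u) ⊑ (ws ∷ʳ v)
  ∷ʳ-⊑-∷ʳ {v = v} u≢[] u≼v with n , eq ← Pop₁-reaches (reverseView v) u≢[] u≼v = n , 0 , eq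

  Milestone⇒⊑ : ∀ {m s : Stack k} → Milestone m s → m ⊑ s
  Milestone⇒⊑ {s = s} = go (reverseView s)
    where
      go : ∀ {m s} → Reverse s → Milestone m s → m ⊑ s
      go []              M = ⊥-elim (Milestone-[] M)
      go (ws ∶ rws ∶ʳ v) M with Milestone-∷ʳ⁻ ws M
      ... | inj₁ M′ = ⊑-∷ʳ (λ { refl → Milestone-[] M′ }) (go rws M′)
      ... | inj₂ (_ , refl , _ , u≼v , u≢[]) = ∷ʳ-⊑-∷ʳ u≢[] u≼v

  Milestone-total : ∀ {m₁ m₂ s : Stack k} → Milestone m₁ s → Milestone m₂ s → m₁ ⊑ m₂ ⊎ m₂ ⊑ m₁
  Milestone-total {s = s} = go (reverseView s)
    where
      below : ∀ {m ws w} → Milestone m ws → m ⊑ (ws ∷ʳ w)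
      below M = ⊑-∷ʳ (λ { refl → Milestone-[] M }) (Milestone⇒⊑ M)

      go : ∀ {m₁ m₂ s} → Reverse s → Milestone m₁ s → Milestone m₂ s → m₁ ⊑ m₂ ⊎ m₂ ⊑ m₁
      go []              M₁ _  = ⊥-elim (Milestone-[] M₁)
      go (ws ∶ rws ∶ʳ v) M₁ M₂ with Milestone-∷ʳ⁻ ws M₁ | Milestone-∷ʳ⁻ ws M₂
      ... | inj₁ M₁′ | inj₁ M₂′ = go rws M₁′ M₂′
      ... | inj₁ M₁′ | inj₂ (_ , refl , _) = inj₁ (below M₁′)
      ... | inj₂ (_ , refl , _) | inj₁ M₂′ = inj₂ (below M₂′)
      ... | inj₂ (_ , refl , _ , u₁≼v , u₁≢[]) | inj₂ (_ , refl , _ , u₂≼v , u₂≢[]) =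
        Sum.map (∷ʳ-⊑-∷ʳ u₁≢[]) (∷ʳ-⊑-∷ʳ u₂≢[]) (≼-comparable u₁≼v u₂≼v)

  iterM-IsStack : ∀ op n {s t : Stack k} → iterM (apply op) n s ≡ just t → IsStack s → IsStack t
  iterM-IsStack op zero    refl s-stack = s-stack
  iterM-IsStack op (suc n) eq   s-stack with _ , e , eq′ ← >>=≡just⇒ eq =
    iterM-IsStack op n eq′ (step op s-stack e)

  ⊑-IsStack : ∀ {m s : Stack k} → IsStack s → m ⊑ s → IsStack m
  ⊑-IsStack s-stack (n₁ , n₂ , eq) with _ , e₂ , e₁ ← >>=≡just⇒ eq =
    iterM-IsStack pop1 n₁ e₁ (iterM-IsStack pop2 n₂ e₂ s-stack)

  weight : Stack k → ℕ
  weight = sum ∘ map (suc ∘ length)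

  weight-++ : (xs ys : Stack k) → weight (xs ++ ys) ≡ weight xs ℕ.+ weight ys
  weight-++ xs ys =
    trans (cong sum (map-++ (suc ∘ length) xs ys)) (sum-++ (map (suc ∘ length) xs) _)

  weight-Pop₂ : ∀ {s t : Stack k} → Pop₂ s ≡ just t → weight t < weight s
  weight-Pop₂ {s} {t} eq with w , refl ← Pop₂≡just⇒ {s} eq
    rewrite weight-++ t [ w ] = ℕP.m<m+n (weight t) (s≤s z≤n)

  weight-Pop₁ : ∀ {s t : Stack k} → Pop₁ s ≡ just t → weight t < weight s
  weight-Pop₁ {s} eq with ws , v , a , _ , refl , refl ← Pop₁≡just⇒ {s} eq
    rewrite weight-++ ws [ v ] | weight-++ ws [ v ∷ʳ a ] | length-∷ʳ v a =
    ℕP.+-monoʳ-< (weight ws) (ℕP.n<1+n _)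

  iterM-lighter : ∀ {f : Stack k → Maybe (Stack k)} →
                  (∀ {s t} → f s ≡ just t → weight t < weight s) →
                  ∀ n {s t} → iterM f n s ≡ just t → t ≡ s ⊎ weight t < weight s
  iterM-lighter f↓ zero    refl = inj₁ refl
  iterM-lighter f↓ (suc n) eq with z , e , eq′ ← >>=≡just⇒ eq with iterM-lighter f↓ n {z} eq′
  ... | inj₁ refl = inj₂ (f↓ e)
  ... | inj₂ t<z  = inj₂ (ℕP.<-trans t<z (f↓ e))

  ⊑-lighter : ∀ {m s : Stack k} → m ⊑ s → m ≡ s ⊎ weight m < weight s
  ⊑-lighter (n₁ , n₂ , eq) with z , e₂ , e₁ ← >>=≡just⇒ eq
    with iterM-lighter (λ {s} → weight-Pop₂ {s}) n₂ e₂
       | iterM-lighter (λ {s} → weight-Pop₁ {s}) n₁ {z} e₁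
  ... | inj₁ refl | m≤z      = m≤z
  ... | inj₂ z<s  | inj₁ refl = inj₂ z<s
  ... | inj₂ z<s  | inj₂ m<z  = inj₂ (ℕP.<-trans m<z z<s)

  ⊑-antisym : ∀ {m s : Stack k} → m ⊑ s → s ⊑ m → m ≡ s
  ⊑-antisym m⊑s s⊑m with ⊑-lighter m⊑s | ⊑-lighter s⊑m
  ... | inj₁ m≡s | _         = m≡s
  ... | inj₂ _   | inj₁ s≡m  = sym s≡m
  ... | inj₂ m<s | inj₂ s<m  = ⊥-elim (ℕP.<-asym m<s s<m)

last-index : ∀ n {P : Pred (Fin (suc n)) 0ℓ} → Decidable P → ∃ P → ∃ λ i → P i × (∀ j → P j → j ≤ i)
last-index zero    _  (zero , p) = zero , p , λ { zero _ → z≤n }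
last-index (suc n) {P} P? (i , p) with FinP.any? (P? ∘ suc)
... | yes p⁺ with i′ , p′ , max ← last-index n (P? ∘ suc) p⁺ =
  suc i′ , p′ , λ { zero _ → z≤n ; (suc j) pj → s≤s (max j pj) }
... | no ¬p⁺ = zero , p₀ i p , λ { zero _ → z≤n ; (suc j) pj → ⊥-elim (¬p⁺ (j , pj)) }
  where
    p₀ : ∀ i → P i → P zero
    p₀ zero    p = p
    p₀ (suc i) p = ⊥-elim (¬p⁺ (i , p))

module _ {k : ℕ} (S : CPS k) where

  Step⇒↝ : ∀ {c c′} → Step S c c′ → proj₂ c ↝ proj₂ c′
  Step⇒↝ (_ , op , _ , _ , e) = apply⇒↝ op e

  run-IsStack : ∀ {n} (r : Fin (suc n) → Config S) → IsRun S n r →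
                IsStack (proj₂ (r zero)) → ∀ i → IsStack (proj₂ (r i))
  run-IsStack r run r₀-stack zero = r₀-stack
  run-IsStack {suc n} r run r₀-stack (suc i) with _ , op , _ , _ , e ← run zero =
    run-IsStack (r ∘ suc) (run ∘ suc) (step op r₀-stack e) i

  Milestone-run⁻ : ∀ {n m} (r : Fin (suc n) → Config S) → IsRun S n r →
                   Milestone m (proj₂ (r (fromℕ n))) →
                   ∀ i → Milestone m (proj₂ (r i)) ⊎ ∃ λ j → i ≤ j × proj₂ (r j) ≡ m
  Milestone-run⁻ {zero}  r run M zero = inj₁ M
  Milestone-run⁻ {suc n} r run M (suc i) =
    Sum.map₂ (λ { (j , i≤j , e) → suc j , s≤s i≤j , e }) (Milestone-run⁻ (r ∘ suc) (run ∘ suc) M i)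
  Milestone-run⁻ {suc n} r run M zero with Milestone-run⁻ (r ∘ suc) (run ∘ suc) M zero
  ... | inj₂ (j , _ , e) = inj₂ (suc j , z≤n , e)
  ... | inj₁ M₁ with Milestone-↝⁻ (Step⇒↝ (run zero)) M₁
  ...   | inj₁ e  = inj₂ (suc zero , z≤n , sym e)
  ...   | inj₂ M₀ = inj₁ M₀

  visit-≤-lastVisit : ∀ {n m₁ m₂ i i₂} (r : Fin (suc n) → Config S) → IsRun S n r →
                      Milestone m₂ (proj₂ (r (fromℕ n))) →
                      proj₂ (r i) ≡ m₁ → m₁ ⊑ m₂ → IsLastVisit r m₂ i₂ → i ≤ i₂
  visit-≤-lastVisit {i = i} r run M₂ rᵢ≡m₁ m₁⊑m₂ (_ , last) with Milestone-run⁻ r run M₂ i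
  ... | inj₁ M             =
    last i (trans rᵢ≡m₁ (⊑-antisym m₁⊑m₂ (subst (_ ⊑_) rᵢ≡m₁ (Milestone⇒⊑ M))))
  ... | inj₂ (j , i≤j , e) = FinP.≤-trans i≤j (last j e)

  lastVisit-≤⇒⊑ : ∀ {n m₁ m₂ i₁ i₂} (r : Fin (suc n) → Config S) → IsRun S n r →
                  Milestone m₁ (proj₂ (r (fromℕ n))) → Milestone m₂ (proj₂ (r (fromℕ n))) →
                  IsLastVisit r m₁ i₁ → IsLastVisit r m₂ i₂ → i₁ ≤ i₂ → m₁ ⊑ m₂
  lastVisit-≤⇒⊑ r run M₁ M₂ lv₁ lv₂ i₁≤i₂ with Milestone-total M₁ M₂
  ... | inj₁ m₁⊑m₂ = m₁⊑m₂
  ... | inj₂ m₂⊑m₁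
    with refl ← FinP.≤-antisym i₁≤i₂ (visit-≤-lastVisit r run M₁ (proj₁ lv₂) m₂⊑m₁ lv₁)
    with refl ← trans (sym (proj₁ lv₁)) (proj₁ lv₂) = ⊑-refl _

  milestone-visited : ∀ (s t m : Stack k) → IsStack s → IsStack t → IsStack m →
    IsMilestone m t → ¬ (m ⊑ s) →
    ∀ n (r : Fin (suc n) → Config S) → IsRun S n r →
    proj₂ (r zero) ≡ s → proj₂ (r (fromℕ n)) ≡ t →
    Visits r m
  milestone-visited s t m _ _ m-stack m∈t m⋢s n r run r₀ rₙ
    with Milestone-run⁻ r run (subst (Milestone m) (sym rₙ) (IsMilestone⇒Milestone m-stack m∈t))
                        zero
  ... | inj₁ M₀          = ⊥-elim (m⋢s (subst (m ⊑_) r₀ (Milestone⇒⊑ M₀)))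
  ... | inj₂ (j , _ , e) = j , e

  lastVisit-orderEmbedding : ∀ (s : Stack k) n (r : Fin (suc n) → Config S) → IsRun S n r →
    r zero ≡ (CPS.q₀ S , bot₂) → proj₂ (r (fromℕ n)) ≡ s →
    (∀ m → IsMilestone m s → ∃ λ i → IsLastVisit r m i)
    ×
    (∀ m₁ m₂ i₁ i₂ → IsMilestone m₁ s → IsMilestone m₂ s →
       IsLastVisit r m₁ i₁ → IsLastVisit r m₂ i₂ →
       (m₁ ⊑ m₂ → i₁ ≤ i₂) × (i₁ ≤ i₂ → m₁ ⊑ m₂))
  lastVisit-orderEmbedding s n r run r₀ rₙ =
      (λ m m∈s → last-index n (λ i → ≡-dec (≡-dec _≟ₗ_) (proj₂ (r i)) m) (visited (milestone m∈s)))
    , λ m₁ m₂ i₁ i₂ m₁∈s m₂∈s lv₁ lv₂ →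
          (λ m₁⊑m₂ → visit-≤-lastVisit r run (milestone m₂∈s) (proj₁ lv₁) m₁⊑m₂ lv₂)
        , lastVisit-≤⇒⊑ r run (milestone m₁∈s) (milestone m₂∈s) lv₁ lv₂
    where
      r₀≡bot₂ : proj₂ (r zero) ≡ bot₂
      r₀≡bot₂ = cong proj₂ r₀

      milestone : ∀ {m} → IsMilestone m s → Milestone m (proj₂ (r (fromℕ n)))
      milestone m∈s = subst (Milestone _) (sym rₙ)
        (IsMilestone⇒Milestone (⊑-IsStack s-stack (proj₁ m∈s)) m∈s)
        where
          s-stack : IsStack s
          s-stack = subst IsStack rₙ
            (run-IsStack r run (subst IsStack (sym r₀≡bot₂) base) (fromℕ n))

      visited : ∀ {m} → Milestone m (proj₂ (r (fromℕ n))) → Visits r m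
      visited M with Milestone-run⁻ r run M zero
      ... | inj₁ M₀          =
        zero , trans r₀≡bot₂ (sym (Milestone-bot₂ (subst (Milestone _) r₀≡bot₂ M₀)))
      ... | inj₂ (j , _ , e) = j , e

mainTheorem4 : ∀ {k} (S : CPS k) →
    (∀ (s t m : Stack k) → IsStack s → IsStack t → IsStack m →
       IsMilestone m t → ¬ (m ⊑ s) →
       ∀ n (r : Fin (suc n) → Config S) → IsRun S n r →
       proj₂ (r zero) ≡ s → proj₂ (r (fromℕ n)) ≡ t →
       Visits r m)
    ×
    (∀ (s : Stack k) n (r : Fin (suc n) → Config S) → IsRun S n r →
       r zero ≡ (CPS.q₀ S , bot₂) → proj₂ (r (fromℕ n)) ≡ s →
       (∀ m → IsMilestone m s → ∃ λ i → IsLastVisit r m i)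
       ×
       (∀ m₁ m₂ i₁ i₂ → IsMilestone m₁ s → IsMilestone m₂ s →
          IsLastVisit r m₁ i₁ → IsLastVisit r m₂ i₂ →
          (m₁ ⊑ m₂ → i₁ ≤ i₂) × (i₁ ≤ i₂ → m₁ ⊑ m₂)))
mainTheorem4 S = milestone-visited S , lastVisit-orderEmbedding S
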